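{- Let $\mathcal{C}$ be a colored $(k+1)$-configuration with point set $P(\mathcal{C})$, and let $\phi_c$ ($c\in[k+1]$) be the color maps of its incidence graph. Call a map $\ell\colon A_k\to P(\mathcal{C})$ admissible if for all $\vec{u}\in A_k$ and all distinct $i,j\in[k+1]$ we have $\ell(\vec{u}-\vec{e}_i+\vec{e}_j)=(\phi_j\circ\phi_i)(\ell(\vec{u}))$. For each $\vec{v}_0\in A_k$ and $p_0\in P(\mathcal{C})$ there is a unique admissible $\ell$ with $\ell(\vec{v}_0)=p_0$. If $\ell$ is the admissible map with $\ell(\vec{v}_0)=p_0$ and $\ell'$ is the admissible map with $\ell'(\vec{v}_0')=p_0'$ (for arbitrary $\vec{v}_0,\vec{v}_0'\in A_k$, $p_0,p_0'\in P(\mathcal{C})$), then there exists a permutation $\sigma$ of $P(\mathcal{C})$ with $\ell'=\sigma\circ\ell$.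
   Context: A $k$-configuration consists of finite sets $P$ (points), $L$ (lines) and an incidence relation $R\subseteq P\times L$ such that: (i) there do not exist distinct $p_1,p_2\in P$ and distinct $l_1,l_2\in L$ with $(p_i,l_j)\in R$ for all $i,j\in\{1,2\}$; (ii) each point is incident with exactly $k$ lines; (iii) each line is incident with exactly $k$ points. Its incidence graph $G(\mathcal{C})$ has vertex set $P\sqcup L$ and an edge $\{p,l\}$ for each $(p,l)\in R$; $\mathcal{C}$ is connected if $G(\mathcal{C})$ is. A $k$-edge coloring of a graph is a map $\chi\colon E\to[k]=\{1,\dots,k\}$ assigning distinct colors to distinct edges sharing a vertex. For a $k$-regular bipartite graph with a $k$-edge coloring and a color $c$, $\phi_c(v)$ is the unique neighbor $w$ of $v$ with $\chi(vw)=c$. The coloring has the 6-cycle property if for every vertex $v$ and all distinct colors $a,b,c$, $(\phi_c\circ\phi_b\circ\phi_a\circ\phi_c\circ\phi_b\circ\phi_a)(v)=v$. A colored $k$-configuration is a connected $k$-configuration together with a $k$-edge coloring of $G(\mathcal{C})$ with the 6-cycle property. $A_k=\{\vec{x}\in\mathbb{Z}^{k+1}:\sum_i x_i=0\}$; $\vec{e}_i$ are the standard basis vectors of $\mathbb{Z}^{k+1}$. -}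

module Defs where

open import Data.Nat using (ℕ; suc)
open import Data.Fin using (Fin)
open import Data.Fin.Properties using (_≟_)
open import Data.Bool using (Bool; true; false; T; if_then_else_)
open import Data.List using (length; filter)
open import Data.List using () renaming ([] to []ₗ)
open import Data.Fin using () renaming (zero to fzero)
import Data.List as List
open import Data.Fin.Base using () 
open import Data.Vec using (Vec; tabulate; zipWith; foldr)
open import Data.Integer using (ℤ; _+_; _-_; 0ℤ; 1ℤ)
open import Data.Sum using (_⊎_; inj₁; inj₂)
open import Data.Product using (Σ; ∃; ∃-syntax; _×_; _,_; proj₁)
open import Data.Empty using (⊥)
open import Relation.Nullary using (¬_; does)
open import Relation.Nullary.Decidable using (T?)
open import Relation.Binary.PropositionalEquality using (_≡_; _≢_)
open import Relation.Binary.Construct.Closure.ReflexiveTransitive using (Star)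
open import Data.List.Base using () renaming (allFin to allFinL)

lineDeg : {np nl : ℕ} → (Fin np → Fin nl → Bool) → Fin np → ℕ
lineDeg {nl = nl} R p = length (filter (λ l → T? (R p l)) (allFinL nl))

pointDeg : {np nl : ℕ} → (Fin np → Fin nl → Bool) → Fin nl → ℕ
pointDeg {np = np} R l = length (filter (λ p → T? (R p l)) (allFinL np))

Vert : ℕ → ℕ → Set
Vert np nl = Fin np ⊎ Fin nl

Adj : {np nl : ℕ} → (Fin np → Fin nl → Bool) → Vert np nl → Vert np nl → Set
Adj R (inj₁ p) (inj₂ l) = T (R p l)
Adj R (inj₂ l) (inj₁ p) = T (R p l)
Adj R _ _ = ⊥

record Configuration (K : ℕ) : Set where
  field
    np nl : ℕ
    R : Fin np → Fin nl → Bool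
    noDigon : ∀ (p₁ p₂ : Fin np) (l₁ l₂ : Fin nl) → p₁ ≢ p₂ → l₁ ≢ l₂ →
              ¬ (T (R p₁ l₁) × T (R p₁ l₂) × T (R p₂ l₁) × T (R p₂ l₂))
    pointReg : ∀ p → lineDeg R p ≡ K
    lineReg : ∀ l → pointDeg R l ≡ K

open Configuration public

Connected : ∀ {K} → Configuration K → Set
Connected C = ∀ v w → Star (Adj (R C)) v w

-- A K-edge coloring of G(C): the edge {p,l} (with (p,l) ∈ R) gets color
-- χ p l _ ∈ Fin K (Fin K stands for [K] = {1,…,K}).
EdgeColoring : ∀ {K} → Configuration K → Set
EdgeColoring {K} C = (p : Fin (np C)) (l : Fin (nl C)) → T (R C p l) → Fin K

Proper : ∀ {K} (C : Configuration K) → EdgeColoring C → Set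
Proper C χ =
  (∀ p l l' (r : T (R C p l)) (r' : T (R C p l')) → l ≢ l' → χ p l r ≢ χ p l' r')
  × (∀ p p' l (r : T (R C p l)) (r' : T (R C p' l)) → p ≢ p' → χ p l r ≢ χ p' l r')

-- "φ_c(v) = w": w is the (unique, by properness) neighbour of v whose
-- edge with v has color c.
Phi : ∀ {K} (C : Configuration K) → EdgeColoring C → Fin K →
      Vert (np C) (nl C) → Vert (np C) (nl C) → Set
Phi C χ c (inj₁ p) (inj₂ l) = Σ (T (R C p l)) λ r → χ p l r ≡ c
Phi C χ c (inj₂ l) (inj₁ p) = Σ (T (R C p l)) λ r → χ p l r ≡ c
Phi C χ c _ _ = ⊥

-- 6-cycle property: (φ_c∘φ_b∘φ_a∘φ_c∘φ_b∘φ_a)(v) = v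
SixCycle : ∀ {K} (C : Configuration K) → EdgeColoring C → Set
SixCycle C χ = ∀ v (a b c : Fin _) → a ≢ b → b ≢ c → a ≢ c →
  ∃[ v₁ ] ∃[ v₂ ] ∃[ v₃ ] ∃[ v₄ ] ∃[ v₅ ]
    (Phi C χ a v v₁ × Phi C χ b v₁ v₂ × Phi C χ c v₂ v₃ ×
     Phi C χ a v₃ v₄ × Phi C χ b v₄ v₅ × Phi C χ c v₅ v)

record ColoredConfiguration (K : ℕ) : Set where
  field
    conf : Configuration K
    connected : Connected conf
    χ : EdgeColoring conf
    proper : Proper conf χ
    sixCycle : SixCycle conf χ

sumℤ : ∀ {n} → Vec ℤ n → ℤ
sumℤ = foldr _ _+_ 0ℤ

A : ℕ → Set
A k = Σ (Vec ℤ (suc k)) λ x → sumℤ x ≡ 0ℤ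

e : ∀ {k} → Fin (suc k) → Vec ℤ (suc k)
e i = tabulate λ j → if does (i ≟ j) then 1ℤ else 0ℤ

shift : ∀ {k} → Vec ℤ (suc k) → Fin (suc k) → Fin (suc k) → Vec ℤ (suc k)
shift u i j = zipWith _+_ (zipWith _-_ u (e i)) (e j)

Admissible : ∀ {k} (C : ColoredConfiguration (suc k)) →
             (A k → Fin (np (ColoredConfiguration.conf C))) → Set
Admissible {k} C ℓ =
  ∀ (u u' : A k) (i j : Fin (suc k)) → i ≢ j → proj₁ u' ≡ shift (proj₁ u) i j →
    ∃[ m ] (Phi conf χ i (inj₁ (ℓ u)) (inj₂ m) × Phi conf χ j (inj₂ m) (inj₁ (ℓ u')))
  where open ColoredConfiguration C

-- Because the k + 1 edges at a vertex carry distinct colours, every colour map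
-- φ_c is a bijection between points and lines, so φ_j ∘ φ_i permutes the points.
-- The six-cycle property says precisely that the translations t_c = φ_c ∘ φ_0
-- commute, and φ_j ∘ φ_i = t_j ∘ t_i⁻¹. Hence ℓ(u) = (Π_m t_m^(u_m - v₀_m))(p₀)
-- is admissible. The lattice A_k is connected by the steps u ↦ u - e_i + e_j, so
-- if σ commutes with all the moves φ_j ∘ φ_i and ℓ'(v₀) = σ(ℓ(v₀)), then
-- ℓ' = σ ∘ ℓ; σ = id gives uniqueness, and a path from ℓ(v₀) to ℓ'(v₀) in the
-- connected incidence graph gives such a σ as a composite of moves.

module Submission where

open import Defs
open import Data.Nat using (ℕ; suc)
open import Data.Fin using (Fin)
open import Data.Product using (Σ; _×_)
open import Function.Bundles using (_↔_; Inverse)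
open import Relation.Binary.PropositionalEquality using (_≡_)

open import Data.Nat using (_<_)
open import Data.Nat.Properties using (n<1+n)
open import Data.Fin using (zero; suc; punchOut)
open import Data.Fin.Properties using (pigeonhole; <⇒≢; punchOut-injective; any?; suc-injective)
  renaming (_≟_ to _≟ᶠ_)
open import Data.Integer as ℤ using (ℤ; +_; -[1+_]; 0ℤ; 1ℤ; -1ℤ; _+_; _-_)
open import Data.Integer.Properties using (+-identityˡ; +-identityʳ; +-inverseʳ)
  renaming (_≟_ to _≟ℤ_)
open import Data.Integer.Tactic.RingSolver using (solve-∀)
open import Data.Product using (_,_; proj₁; proj₂; ∃-syntax)
open import Data.Sum using (inj₁; inj₂)
open import Data.Empty using (⊥; ⊥-elim)
open import Data.Bool using (Bool; T; if_then_else_)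
open import Data.Bool.Properties using (T-irrelevant)
open import Data.List as List using (List; _∷_; length; lookup; filter)
open import Data.List.Relation.Unary.Unique.Propositional using (Unique)
import Data.List.Relation.Unary.Unique.Propositional.Properties as Unique
open import Data.List.Relation.Unary.AllPairs using (_∷_)
import Data.List.Relation.Unary.All as All
open import Data.List.Membership.Propositional using (_∈_)
open import Data.List.Membership.Propositional.Properties using (∈-lookup; ∈-filter⁻)
open import Data.Vec using (Vec; _∷_; zipWith)
import Data.Vec as Vec
import Data.Vec.Properties as Vec
open import Relation.Nullary using (Dec; yes; no; does)
open import Relation.Nullary.Decidable using (T?)
open import Relation.Binary.Construct.Closure.ReflexiveTransitive using (Star; ε; _◅_)
open import Function.Bundles using (mk↔ₛ′)
open import Function.Construct.Identity using (↔-id)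
open import Function.Construct.Composition using (_↔-∘_)
open import Relation.Binary.PropositionalEquality
  using (refl; sym; trans; cong; cong₂; subst; _≢_; module ≡-Reasoning)
import Axiom.UniquenessOfIdentityProofs as UIP

lookup-injective : ∀ {B : Set} {xs : List B} → Unique xs →
  ∀ i j → lookup xs i ≡ lookup xs j → i ≡ j
lookup-injective (_ ∷ _)       zero    zero    _  = refl
lookup-injective (x∉xs ∷ _)    zero    (suc j) eq = ⊥-elim (All.lookup x∉xs (∈-lookup j) eq)
lookup-injective (x∉xs ∷ _)    (suc i) zero    eq = ⊥-elim (All.lookup x∉xs (∈-lookup i) (sym eq))
lookup-injective (_ ∷ unique) (suc i) (suc j) eq = cong suc (lookup-injective unique i j eq)

pigeonhole-∈ : ∀ {B : Set} {m} (xs : List B) → Unique xs → length xs ≡ suc m →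
  (g : ∀ x → x ∈ xs → Fin m) → (∀ x y x∈ y∈ → g x x∈ ≡ g y y∈ → x ≡ y) → ⊥
pigeonhole-∈ {m = m} xs unique len g g-injective
  with pigeonhole (subst (m <_) (sym len) (n<1+n m)) (λ i → g (lookup xs i) (∈-lookup i))
... | i , j , i<j , eq = <⇒≢ i<j (lookup-injective unique i j (g-injective _ _ _ _ eq))

every-colour-occurs : ∀ {n k} (r : Fin n → Bool) (col : ∀ y → T (r y) → Fin (suc k)) →
  (∀ y y' (ry : T (r y)) (ry' : T (r y')) → y ≢ y' → col y ry ≢ col y' ry') →
  length (filter (λ y → T? (r y)) (List.allFin n)) ≡ suc k →
  ∀ c → ∃[ y ] Σ (T (r y)) (λ ry → col y ry ≡ c)
-- If c were missing, punching it out would inject the k + 1 elements y with r y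
-- into the k remaining colours.
every-colour-occurs {n} {k} r col col-injective degree c with any? has-colour-c
  where
    has-colour-c : ∀ y → Dec (Σ (T (r y)) (λ ry → col y ry ≡ c))
    has-colour-c y with T? (r y)
    ... | no ¬ry = no (λ (ry , _) → ¬ry ry)
    ... | yes ry with col y ry ≟ᶠ c
    ...   | yes eq = yes (ry , eq)
    ...   | no neq = no (λ (ry' , eq) → neq (subst (λ ry → col y ry ≡ c) (T-irrelevant ry' ry) eq))
... | yes found = found
... | no missing = ⊥-elim (pigeonhole-∈ ys ys-unique degree g g-injective)
  where
    ys : List (Fin n)
    ys = filter (λ y → T? (r y)) (List.allFin n)
    ys-unique : Unique ys
    ys-unique = Unique.filter⁺ (λ y → T? (r y)) (Unique.allFin⁺ n)
    r∈ : ∀ y → y ∈ ys → T (r y)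
    r∈ y y∈ = proj₂ (∈-filter⁻ (λ y → T? (r y)) {xs = List.allFin n} y∈)
    c≢col : ∀ y y∈ → c ≢ col y (r∈ y y∈)
    c≢col y y∈ eq = missing (y , r∈ y y∈ , sym eq)
    g : ∀ y → y ∈ ys → Fin k
    g y y∈ = punchOut (c≢col y y∈)
    g-injective : ∀ y y' y∈ y'∈ → g y y∈ ≡ g y' y'∈ → y ≡ y'
    g-injective y y' y∈ y'∈ eq with y ≟ᶠ y'
    ... | yes y≡y' = y≡y'
    ... | no y≢y' = ⊥-elim (col-injective y y' _ _ y≢y' (punchOut-injective (c≢col y y∈) (c≢col y' y'∈) eq))

ℤ-bi-induction : ∀ (Q : ℤ → Set) → Q 0ℤ → (∀ z → Q z → Q (ℤ.suc z)) → (∀ z → Q z → Q (ℤ.pred z)) →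
  ∀ z → Q z
ℤ-bi-induction Q q₀ up down (+ 0)            = q₀
ℤ-bi-induction Q q₀ up down (+ (suc n))      = up (+ n) (ℤ-bi-induction Q q₀ up down (+ n))
ℤ-bi-induction Q q₀ up down -[1+ 0 ]         = down 0ℤ q₀
ℤ-bi-induction Q q₀ up down -[1+ (suc n) ]   = down -[1+ n ] (ℤ-bi-induction Q q₀ up down -[1+ n ])

ShiftClosed : ∀ {n} → (Vec ℤ (suc n) → Set) → Set
ShiftClosed S = ∀ w i j → i ≢ j → S w → S (shift w i j)

x-0+0≡x : ∀ x → x - 0ℤ + 0ℤ ≡ x
x-0+0≡x = solve-∀

shift-suc : ∀ {n} x (w : Vec ℤ (suc n)) i j → shift (x ∷ w) (suc i) (suc j) ≡ x ∷ shift w i j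
shift-suc x w i j = cong (_∷ shift w i j) (x-0+0≡x x)

zeros : ∀ n → Vec ℤ n
zeros n = Vec.tabulate (λ _ → 0ℤ)

zipWith-sub-add-zeros : ∀ {n} (w : Vec ℤ n) → zipWith _+_ (zipWith _-_ w (zeros n)) (zeros n) ≡ w
zipWith-sub-add-zeros Vec.[] = refl
zipWith-sub-add-zeros (x ∷ w) = cong₂ _∷_ (x-0+0≡x x) (zipWith-sub-add-zeros w)

shift-10 : ∀ {n} a b (w : Vec ℤ n) → shift (a ∷ b ∷ w) (suc zero) zero ≡ ℤ.suc a ∷ ℤ.pred b ∷ w
shift-10 a b w = cong₂ _∷_ (a-0+1≡1+a a) (cong₂ _∷_ (b-1+0≡-1+b b) (zipWith-sub-add-zeros w))
  where
    a-0+1≡1+a : ∀ a → a - 0ℤ + 1ℤ ≡ 1ℤ + a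
    a-0+1≡1+a = solve-∀
    b-1+0≡-1+b : ∀ b → b - 1ℤ + 0ℤ ≡ -1ℤ + b
    b-1+0≡-1+b = solve-∀

shift-01 : ∀ {n} a b (w : Vec ℤ n) → shift (a ∷ b ∷ w) zero (suc zero) ≡ ℤ.pred a ∷ ℤ.suc b ∷ w
shift-01 a b w = cong₂ _∷_ (a-1+0≡-1+a a) (cong₂ _∷_ (b-0+1≡1+b b) (zipWith-sub-add-zeros w))
  where
    a-1+0≡-1+a : ∀ a → a - 1ℤ + 0ℤ ≡ -1ℤ + a
    a-1+0≡-1+a = solve-∀
    b-0+1≡1+b : ∀ b → b - 0ℤ + 1ℤ ≡ 1ℤ + b
    b-0+1≡1+b = solve-∀

module _ {n} (S : Vec ℤ (suc (suc n)) → Set) (closed : ShiftClosed S) where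

  redistribute : ∀ x y w d → S (x ∷ y ∷ w) → S ((x + d) ∷ (y - d) ∷ w)
  redistribute x y w d s = ℤ-bi-induction (λ d → S ((x + d) ∷ (y - d) ∷ w)) base up down d
    where
      x+0≡x : ∀ x → x + 0ℤ ≡ x
      x+0≡x = solve-∀
      x-0≡x : ∀ x → x - 0ℤ ≡ x
      x-0≡x = solve-∀
      base : S ((x + 0ℤ) ∷ (y - 0ℤ) ∷ w)
      base = subst S (sym (cong₂ (λ a b → a ∷ b ∷ w) (x+0≡x x) (x-0≡x y))) s
      up : ∀ d → S ((x + d) ∷ (y - d) ∷ w) → S ((x + ℤ.suc d) ∷ (y - ℤ.suc d) ∷ w)
      up d s = subst S (trans (shift-10 (x + d) (y - d) w) (cong₂ (λ a b → a ∷ b ∷ w) (inc x d) (dec y d)))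
                 (closed _ (suc zero) zero (λ ()) s)
        where inc : ∀ x d → 1ℤ + (x + d) ≡ x + (1ℤ + d)
              inc = solve-∀
              dec : ∀ y d → -1ℤ + (y - d) ≡ y - (1ℤ + d)
              dec = solve-∀
      down : ∀ d → S ((x + d) ∷ (y - d) ∷ w) → S ((x + ℤ.pred d) ∷ (y - ℤ.pred d) ∷ w)
      down d s = subst S (trans (shift-01 (x + d) (y - d) w) (cong₂ (λ a b → a ∷ b ∷ w) (dec x d) (inc y d)))
                 (closed _ zero (suc zero) (λ ()) s)
        where dec : ∀ x d → -1ℤ + (x + d) ≡ x + (-1ℤ + d)
              dec = solve-∀
              inc : ∀ y d → 1ℤ + (y - d) ≡ y - (-1ℤ + d)
              inc = solve-∀

shift-connected : ∀ {n} (S : Vec ℤ (suc n) → Set) → ShiftClosed S →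
  ∀ u v → sumℤ u ≡ sumℤ v → S u → S v
shift-connected {0} S closed (x ∷ Vec.[]) (y ∷ Vec.[]) eq s =
  subst (λ z → S (z ∷ Vec.[])) (trans (sym (+-identityʳ x)) (trans eq (+-identityʳ y))) s
shift-connected {suc n} S closed (x ∷ y ∷ w) (x' ∷ v) eq s =
  shift-connected (λ t → S (x' ∷ t)) tail-closed ((y - d) ∷ w) v tail-sums
    (subst (λ z → S (z ∷ (y - d) ∷ w)) (x+[x'-x]≡x' x x') (redistribute S closed x y w d s))
  where
    d : ℤ
    d = x' - x
    x+[x'-x]≡x' : ∀ x x' → x + (x' - x) ≡ x'
    x+[x'-x]≡x' = solve-∀
    tail-closed : ShiftClosed (λ t → S (x' ∷ t))
    tail-closed t i j i≢j s =
      subst S (shift-suc x' t i j) (closed _ (suc i) (suc j) (λ eq → i≢j (suc-injective eq)) s)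
    tail-sums : (y - d) + sumℤ w ≡ sumℤ v
    tail-sums = begin
        (y - (x' - x)) + sumℤ w   ≡⟨ regroup x x' y (sumℤ w) ⟩
        (x + (y + sumℤ w)) - x'   ≡⟨ cong (_- x') eq ⟩
        (x' + sumℤ v) - x'        ≡⟨ cancel x' (sumℤ v) ⟩
        sumℤ v                    ∎
      where
        open ≡-Reasoning
        regroup : ∀ x x' y s → (y - (x' - x)) + s ≡ (x + (y + s)) - x'
        regroup = solve-∀
        cancel : ∀ x' t → (x' + t) - x' ≡ t
        cancel = solve-∀

lookup-e-self : ∀ {k} (i : Fin (suc k)) → Vec.lookup (e i) i ≡ 1ℤ
lookup-e-self i with i ≟ᶠ i | Vec.lookup∘tabulate (λ m → if does (i ≟ᶠ m) then 1ℤ else 0ℤ) i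
... | yes _  | eq = eq
... | no i≢i | _  = ⊥-elim (i≢i refl)

lookup-e-other : ∀ {k} (i m : Fin (suc k)) → i ≢ m → Vec.lookup (e i) m ≡ 0ℤ
lookup-e-other i m i≢m with i ≟ᶠ m | Vec.lookup∘tabulate (λ m → if does (i ≟ᶠ m) then 1ℤ else 0ℤ) m
... | yes i≡m | _  = ⊥-elim (i≢m i≡m)
... | no _    | eq = eq

lookup-shift : ∀ {k} (w : Vec ℤ (suc k)) i j m →
  Vec.lookup (shift w i j) m ≡ Vec.lookup w m - Vec.lookup (e i) m + Vec.lookup (e j) m
lookup-shift w i j m = trans (Vec.lookup-zipWith _+_ m (zipWith _-_ w (e i)) (e j))
  (cong (_+ Vec.lookup (e j) m) (Vec.lookup-zipWith _-_ m w (e i)))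

sumℤ-zipWith-+ : ∀ {n} (a b : Vec ℤ n) → sumℤ (zipWith _+_ a b) ≡ sumℤ a + sumℤ b
sumℤ-zipWith-+ Vec.[] Vec.[] = refl
sumℤ-zipWith-+ (x ∷ a) (y ∷ b) rewrite sumℤ-zipWith-+ a b = interchange x y (sumℤ a) (sumℤ b)
  where
    interchange : ∀ x y s t → x + y + (s + t) ≡ x + s + (y + t)
    interchange = solve-∀

sumℤ-zipWith-- : ∀ {n} (a b : Vec ℤ n) → sumℤ (zipWith _-_ a b) ≡ sumℤ a - sumℤ b
sumℤ-zipWith-- Vec.[] Vec.[] = refl
sumℤ-zipWith-- (x ∷ a) (y ∷ b) rewrite sumℤ-zipWith-- a b = interchange x y (sumℤ a) (sumℤ b)
  where
    interchange : ∀ x y s t → x - y + (s - t) ≡ x + s - (y + t)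
    interchange = solve-∀

sumℤ-zeros : ∀ n → sumℤ (zeros n) ≡ 0ℤ
sumℤ-zeros 0       = refl
sumℤ-zeros (suc n) = cong (λ z → 0ℤ + z) (sumℤ-zeros n)

sumℤ-e : ∀ {k} (i : Fin (suc k)) → sumℤ (e i) ≡ 1ℤ
sumℤ-e {k}     zero    = cong (λ z → 1ℤ + z) (sumℤ-zeros k)
sumℤ-e {suc k} (suc i) = trans (+-identityˡ _) (sumℤ-e i)

sumℤ-shift : ∀ {k} (w : Vec ℤ (suc k)) i j → sumℤ (shift w i j) ≡ sumℤ w
sumℤ-shift w i j = begin
    sumℤ (shift w i j)                          ≡⟨ sumℤ-zipWith-+ (zipWith _-_ w (e i)) (e j) ⟩
    sumℤ (zipWith _-_ w (e i)) + sumℤ (e j)     ≡⟨ cong₂ _+_ (sumℤ-zipWith-- w (e i)) (sumℤ-e j) ⟩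
    sumℤ w - sumℤ (e i) + 1ℤ                    ≡⟨ cong (λ z → sumℤ w - z + 1ℤ) (sumℤ-e i) ⟩
    sumℤ w - 1ℤ + 1ℤ                            ≡⟨ x-1+1≡x (sumℤ w) ⟩
    sumℤ w                                      ∎
  where
    open ≡-Reasoning
    x-1+1≡x : ∀ x → x - 1ℤ + 1ℤ ≡ x
    x-1+1≡x = solve-∀

A-connected : ∀ {k} (Q : A k → Set) →
  (∀ u u' i j → i ≢ j → proj₁ u' ≡ shift (proj₁ u) i j → Q u → Q u') →
  ∀ u v → Q u → Q v
A-connected {k} Q closed (u , Σu≡0) (v , Σv≡0) q
  with shift-connected S S-closed u v (trans Σu≡0 (sym Σv≡0)) (Σu≡0 , q)
  where
    S : Vec ℤ (suc k) → Set
    S w = Σ (sumℤ w ≡ 0ℤ) (λ Σw≡0 → Q (w , Σw≡0))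
    S-closed : ShiftClosed S
    S-closed w i j i≢j (Σw≡0 , q) = Σw'≡0 , closed (w , Σw≡0) (shift w i j , Σw'≡0) i j i≢j refl q
      where
        Σw'≡0 : sumℤ (shift w i j) ≡ 0ℤ
        Σw'≡0 = trans (sumℤ-shift w i j) Σw≡0
... | Σv≡0′ , q′ = subst (λ Σv≡0 → Q (v , Σv≡0)) (UIP.Decidable⇒UIP.≡-irrelevant _≟ℤ_ Σv≡0′ Σv≡0) q′

module _ {P : Set} (f g : P → P) where

  pow : ℤ → P → P
  pow (+ 0)            q = q
  pow (+ (suc n))      q = f (pow (+ n) q)
  pow -[1+ 0 ]         q = g q
  pow -[1+ (suc n) ]   q = g (pow -[1+ n ] q)

  pow-suc : (∀ q → f (g q) ≡ q) → ∀ z q → pow (ℤ.suc z) q ≡ f (pow z q)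
  pow-suc f∘g≗id (+ n)            q = refl
  pow-suc f∘g≗id -[1+ 0 ]         q = sym (f∘g≗id q)
  pow-suc f∘g≗id -[1+ (suc n) ]   q = sym (f∘g≗id _)

  pow-pred : (∀ q → g (f q) ≡ q) → ∀ z q → pow (ℤ.pred z) q ≡ g (pow z q)
  pow-pred g∘f≗id (+ 0)         q = refl
  pow-pred g∘f≗id (+ (suc n))   q = sym (g∘f≗id _)
  pow-pred g∘f≗id -[1+ n ]      q = refl

  pow-comm : ∀ (h : P → P) → (∀ q → f (h q) ≡ h (f q)) → (∀ q → g (h q) ≡ h (g q)) →
    ∀ z q → pow z (h q) ≡ h (pow z q)
  pow-comm h fh≡hf gh≡hg (+ 0)           q = refl
  pow-comm h fh≡hf gh≡hg (+ (suc n))     q = trans (cong f (pow-comm h fh≡hf gh≡hg (+ n) q)) (fh≡hf _)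
  pow-comm h fh≡hf gh≡hg -[1+ 0 ]        q = gh≡hg q
  pow-comm h fh≡hf gh≡hg -[1+ (suc n) ]  q = trans (cong g (pow-comm h fh≡hf gh≡hg -[1+ n ] q)) (gh≡hg _)

module CommutingAction {I P : Set} (t t⁻¹ : I → P → P)
    (t∘t⁻¹ : ∀ a q → t a (t⁻¹ a q) ≡ q) (t⁻¹∘t : ∀ a q → t⁻¹ a (t a q) ≡ q)
    (t-comm : ∀ a b q → t a (t b q) ≡ t b (t a q)) where

  t⁻¹-t-comm : ∀ a b q → t⁻¹ a (t b q) ≡ t b (t⁻¹ a q)
  t⁻¹-t-comm a b q = begin
    t⁻¹ a (t b q)                   ≡⟨ cong (λ z → t⁻¹ a (t b z)) (sym (t∘t⁻¹ a q)) ⟩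
    t⁻¹ a (t b (t a (t⁻¹ a q)))     ≡⟨ cong (t⁻¹ a) (t-comm b a _) ⟩
    t⁻¹ a (t a (t b (t⁻¹ a q)))     ≡⟨ t⁻¹∘t a _ ⟩
    t b (t⁻¹ a q)                   ∎
    where open ≡-Reasoning

  t⁻¹-comm : ∀ a b q → t⁻¹ a (t⁻¹ b q) ≡ t⁻¹ b (t⁻¹ a q)
  t⁻¹-comm a b q = begin
    t⁻¹ a (t⁻¹ b q)                 ≡⟨ cong (λ z → t⁻¹ a (t⁻¹ b z)) (sym (t∘t⁻¹ a q)) ⟩
    t⁻¹ a (t⁻¹ b (t a (t⁻¹ a q)))   ≡⟨ cong (t⁻¹ a) (t⁻¹-t-comm b a _) ⟩
    t⁻¹ a (t a (t⁻¹ b (t⁻¹ a q)))   ≡⟨ t⁻¹∘t a _ ⟩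
    t⁻¹ b (t⁻¹ a q)                 ∎
    where open ≡-Reasoning

  tᶻ : I → ℤ → P → P
  tᶻ a = pow (t a) (t⁻¹ a)

  tᶻ-t-comm : ∀ a z b q → tᶻ a z (t b q) ≡ t b (tᶻ a z q)
  tᶻ-t-comm a z b = pow-comm (t a) (t⁻¹ a) (t b) (t-comm a b) (t⁻¹-t-comm a b) z

  tᶻ-t⁻¹-comm : ∀ a z b q → tᶻ a z (t⁻¹ b q) ≡ t⁻¹ b (tᶻ a z q)
  tᶻ-t⁻¹-comm a z b = pow-comm (t a) (t⁻¹ a) (t⁻¹ b) (λ q → sym (t⁻¹-t-comm b a q)) (t⁻¹-comm a b) z

  -- act cs w = Π_m t (cs m) ^ (w m); indexing through cs lets the recursion on n
  -- keep the family t fixed.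
  act : ∀ {n} → (Fin n → I) → (Fin n → ℤ) → P → P
  act {0}     cs w q = q
  act {suc n} cs w q = tᶻ (cs zero) (w zero) (act (λ m → cs (suc m)) (λ m → w (suc m)) q)

  act-cong : ∀ {n} cs (w w' : Fin n → ℤ) → (∀ m → w m ≡ w' m) → ∀ q → act cs w q ≡ act cs w' q
  act-cong {0}     cs w w' w≗w' q = refl
  act-cong {suc n} cs w w' w≗w' q = cong₂ (tᶻ (cs zero)) (w≗w' zero)
    (act-cong (λ m → cs (suc m)) _ _ (λ m → w≗w' (suc m)) q)

  act-zero : ∀ {n} cs (w : Fin n → ℤ) → (∀ m → w m ≡ 0ℤ) → ∀ q → act cs w q ≡ q
  act-zero {0}     cs w w≗0 q = refl
  act-zero {suc n} cs w w≗0 q = cong₂ (tᶻ (cs zero)) (w≗0 zero)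
    (act-zero (λ m → cs (suc m)) _ (λ m → w≗0 (suc m)) q)

  act-suc : ∀ {n} cs (w w' : Fin n → ℤ) a → w' a ≡ ℤ.suc (w a) → (∀ m → a ≢ m → w' m ≡ w m) →
    ∀ q → act cs w' q ≡ t (cs a) (act cs w q)
  act-suc {suc n} cs w w' zero w'a≡ w'≗w q =
    trans (cong₂ (tᶻ (cs zero)) w'a≡ (act-cong (λ m → cs (suc m)) _ _ (λ m → w'≗w (suc m) (λ ())) q))
          (pow-suc (t (cs zero)) (t⁻¹ (cs zero)) (t∘t⁻¹ (cs zero)) (w zero) _)
  act-suc {suc n} cs w w' (suc a) w'a≡ w'≗w q =
    trans (cong₂ (tᶻ (cs zero)) (w'≗w zero (λ ()))
            (act-suc (λ m → cs (suc m)) (λ m → w (suc m)) (λ m → w' (suc m)) a w'a≡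
               (λ m a≢m → w'≗w (suc m) (λ eq → a≢m (suc-injective eq))) q))
          (tᶻ-t-comm (cs zero) (w zero) (cs (suc a)) _)

  act-pred : ∀ {n} cs (w w' : Fin n → ℤ) a → w' a ≡ ℤ.pred (w a) → (∀ m → a ≢ m → w' m ≡ w m) →
    ∀ q → act cs w' q ≡ t⁻¹ (cs a) (act cs w q)
  act-pred {suc n} cs w w' zero w'a≡ w'≗w q =
    trans (cong₂ (tᶻ (cs zero)) w'a≡ (act-cong (λ m → cs (suc m)) _ _ (λ m → w'≗w (suc m) (λ ())) q))
          (pow-pred (t (cs zero)) (t⁻¹ (cs zero)) (t⁻¹∘t (cs zero)) (w zero) _)
  act-pred {suc n} cs w w' (suc a) w'a≡ w'≗w q =
    trans (cong₂ (tᶻ (cs zero)) (w'≗w zero (λ ()))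
            (act-pred (λ m → cs (suc m)) (λ m → w (suc m)) (λ m → w' (suc m)) a w'a≡
               (λ m a≢m → w'≗w (suc m) (λ eq → a≢m (suc-injective eq))) q))
          (tᶻ-t⁻¹-comm (cs zero) (w zero) (cs (suc a)) _)

module ColourMaps {k : ℕ} (C : ColoredConfiguration (suc k)) where
  open ColoredConfiguration C

  Point Line Colour : Set
  Point  = Fin (np conf)
  Line   = Fin (nl conf)
  Colour = Fin (suc k)

  Coloured : Colour → Point → Line → Set
  Coloured c p l = Phi conf χ c (inj₁ p) (inj₂ l)

  line-unique : ∀ {c p l l'} → Coloured c p l → Coloured c p l' → l ≡ l'
  line-unique {p = p} {l} {l'} (r , χ≡c) (r' , χ'≡c) with l ≟ᶠ l'
  ... | yes l≡l' = l≡l'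
  ... | no l≢l'  = ⊥-elim (proj₁ proper p l l' r r' l≢l' (trans χ≡c (sym χ'≡c)))

  point-unique : ∀ {c l p p'} → Coloured c p l → Coloured c p' l → p ≡ p'
  point-unique {l = l} {p} {p'} (r , χ≡c) (r' , χ'≡c) with p ≟ᶠ p'
  ... | yes p≡p' = p≡p'
  ... | no p≢p'  = ⊥-elim (proj₂ proper p p' l r r' p≢p' (trans χ≡c (sym χ'≡c)))

  line-exists : ∀ c p → ∃[ l ] Coloured c p l
  line-exists c p = every-colour-occurs (R conf p) (χ p)
    (λ l l' r r' → proj₁ proper p l l' r r') (pointReg conf p) c

  point-exists : ∀ c l → ∃[ p ] Coloured c p l
  point-exists c l = every-colour-occurs (λ p → R conf p l) (λ p r → χ p l r)
    (λ p p' r r' → proj₂ proper p p' l r r') (lineReg conf l) c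

  φᴸ : Colour → Point → Line
  φᴸ c p = proj₁ (line-exists c p)

  φᴾ : Colour → Line → Point
  φᴾ c l = proj₁ (point-exists c l)

  φᴸ-unique : ∀ {c p l} → Coloured c p l → φᴸ c p ≡ l
  φᴸ-unique {c} {p} = line-unique (proj₂ (line-exists c p))

  φᴾ-unique : ∀ {c p l} → Coloured c p l → φᴾ c l ≡ p
  φᴾ-unique {c} {l = l} = point-unique (proj₂ (point-exists c l))

  φᴾ∘φᴸ : ∀ c p → φᴾ c (φᴸ c p) ≡ p
  φᴾ∘φᴸ c p = φᴾ-unique (proj₂ (line-exists c p))

  φᴸ∘φᴾ : ∀ c l → φᴸ c (φᴾ c l) ≡ l
  φᴸ∘φᴾ c l = φᴸ-unique (proj₂ (point-exists c l))

  six-cycle : ∀ l a b c → a ≢ b → b ≢ c → a ≢ c →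
    φᴸ c (φᴾ b (φᴸ a (φᴾ c (φᴸ b (φᴾ a l))))) ≡ l
  six-cycle l a b c a≢b b≢c a≢c = closes (sixCycle (inj₂ l) a b c a≢b b≢c a≢c)
    where
      -- A local function rather than `with`, whose abstraction would normalise the φ's in the goal.
      closes : ∃[ v₁ ] ∃[ v₂ ] ∃[ v₃ ] ∃[ v₄ ] ∃[ v₅ ]
          (Phi conf χ a (inj₂ l) v₁ × Phi conf χ b v₁ v₂ × Phi conf χ c v₂ v₃ ×
           Phi conf χ a v₃ v₄ × Phi conf χ b v₄ v₅ × Phi conf χ c v₅ (inj₂ l)) →
        φᴸ c (φᴾ b (φᴸ a (φᴾ c (φᴸ b (φᴾ a l))))) ≡ l
      closes (inj₁ p₁ , inj₂ l₂ , inj₁ p₃ , inj₂ l₄ , inj₁ p₅ , c₁ , c₂ , c₃ , c₄ , c₅ , c₆) = begin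
        φᴸ c (φᴾ b (φᴸ a (φᴾ c (φᴸ b (φᴾ a l)))))  ≡⟨ cong (λ z → φᴸ c (φᴾ b (φᴸ a (φᴾ c (φᴸ b z))))) (φᴾ-unique c₁) ⟩
        φᴸ c (φᴾ b (φᴸ a (φᴾ c (φᴸ b p₁))))         ≡⟨ cong (λ z → φᴸ c (φᴾ b (φᴸ a (φᴾ c z)))) (φᴸ-unique c₂) ⟩
        φᴸ c (φᴾ b (φᴸ a (φᴾ c l₂)))                ≡⟨ cong (λ z → φᴸ c (φᴾ b (φᴸ a z))) (φᴾ-unique c₃) ⟩
        φᴸ c (φᴾ b (φᴸ a p₃))                       ≡⟨ cong (λ z → φᴸ c (φᴾ b z)) (φᴸ-unique c₄) ⟩
        φᴸ c (φᴾ b l₄)                              ≡⟨ cong (φᴸ c) (φᴾ-unique c₅) ⟩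
        φᴸ c p₅                                     ≡⟨ φᴸ-unique c₆ ⟩
        l                                           ∎
        where open ≡-Reasoning

  hexagon : ∀ l a b c → a ≢ b → b ≢ c → a ≢ c →
    φᴾ c (φᴸ b (φᴾ a l)) ≡ φᴾ a (φᴸ b (φᴾ c l))
  hexagon l a b c a≢b b≢c a≢c = begin
    X                                        ≡⟨ sym (φᴾ∘φᴸ a X) ⟩
    φᴾ a (φᴸ a X)                            ≡⟨ cong (φᴾ a) (sym (φᴸ∘φᴾ b _)) ⟩
    φᴾ a (φᴸ b (φᴾ b (φᴸ a X)))              ≡⟨ cong (λ z → φᴾ a (φᴸ b z)) (sym (φᴾ∘φᴸ c _)) ⟩
    φᴾ a (φᴸ b (φᴾ c (φᴸ c (φᴾ b (φᴸ a X))))) ≡⟨ cong (λ z → φᴾ a (φᴸ b (φᴾ c z))) (six-cycle l a b c a≢b b≢c a≢c) ⟩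
    φᴾ a (φᴸ b (φᴾ c l))                     ∎
    where
      open ≡-Reasoning
      X : Point
      X = φᴾ c (φᴸ b (φᴾ a l))

  move : Colour → Colour → Point → Point
  move i j p = φᴾ j (φᴸ i p)

  move-inverse : ∀ i j q → move i j (move j i q) ≡ q
  move-inverse i j q = trans (cong (φᴾ j) (φᴸ∘φᴾ i _)) (φᴾ∘φᴸ j q)

  -- Translations along e_c - e₀ of A_k.
  t t⁻¹ : Colour → Point → Point
  t   c = move zero c
  t⁻¹ c = move c zero

  t-comm : ∀ i j q → t i (t j q) ≡ t j (t i q)
  t-comm i j q = by-cases (i ≟ᶠ j) (i ≟ᶠ zero) (j ≟ᶠ zero)
    where
      t-zero : ∀ q → t zero q ≡ q
      t-zero = φᴾ∘φᴸ zero
      by-cases : ∀ {i j} → Dec (i ≡ j) → Dec (i ≡ zero) → Dec (j ≡ zero) → t i (t j q) ≡ t j (t i q)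
      by-cases (yes refl) _          _          = refl
      by-cases {j = j} (no _) (yes refl) _ = trans (t-zero _) (cong (t j) (sym (t-zero q)))
      by-cases {i = i} (no _) (no _) (yes refl) = trans (cong (t i) (t-zero q)) (sym (t-zero _))
      by-cases {i} {j} (no i≢j) (no i≢0) (no j≢0) =
        hexagon (φᴸ zero q) j zero i j≢0 (λ 0≡i → i≢0 (sym 0≡i)) (λ j≡i → i≢j (sym j≡i))

  move-split : ∀ i j q → move i j q ≡ t j (t⁻¹ i q)
  move-split i j q = cong (φᴾ j) (sym (φᴸ∘φᴾ zero (φᴸ i q)))

  open CommutingAction t t⁻¹ (λ c → move-inverse zero c) (λ c → move-inverse c zero) t-comm public

  move-comm : ∀ a b i j q → move a b (move i j q) ≡ move i j (move a b q)
  move-comm a b i j q = begin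
    move a b (move i j q)          ≡⟨ trans (move-split a b _) (cong (λ z → t b (t⁻¹ a z)) (move-split i j q)) ⟩
    t b (t⁻¹ a (t j (t⁻¹ i q)))    ≡⟨ cong (t b) (t⁻¹-t-comm a j _) ⟩
    t b (t j (t⁻¹ a (t⁻¹ i q)))    ≡⟨ t-comm b j _ ⟩
    t j (t b (t⁻¹ a (t⁻¹ i q)))    ≡⟨ cong (λ z → t j (t b z)) (t⁻¹-comm a i q) ⟩
    t j (t b (t⁻¹ i (t⁻¹ a q)))    ≡⟨ cong (t j) (sym (t⁻¹-t-comm i b _)) ⟩
    t j (t⁻¹ i (t b (t⁻¹ a q)))    ≡⟨ sym (trans (move-split i j _) (cong (λ z → t j (t⁻¹ i z)) (move-split a b q))) ⟩
    move i j (move a b q)          ∎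
    where open ≡-Reasoning

  act-shift : ∀ (w w' : Colour → ℤ) i j →
    (∀ m → w' m ≡ w m - Vec.lookup (e i) m + Vec.lookup (e j) m) →
    ∀ q → act (λ m → m) w' q ≡ move i j (act (λ m → m) w q)
  act-shift w w' i j w'≗ q = begin
    act (λ m → m) w' q               ≡⟨ act-suc (λ m → m) w₁ w' j w'j≡ w'≗w₁ q ⟩
    t j (act (λ m → m) w₁ q)         ≡⟨ cong (t j) (act-pred (λ m → m) w w₁ i w₁i≡ w₁≗w q) ⟩
    t j (t⁻¹ i (act (λ m → m) w q))  ≡⟨ sym (move-split i j _) ⟩
    move i j (act (λ m → m) w q)     ∎
    where
      open ≡-Reasoning
      w₁ : Colour → ℤ
      w₁ m = w m - Vec.lookup (e i) m
      x-1≡pred : ∀ x → x - 1ℤ ≡ -1ℤ + x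
      x-1≡pred = solve-∀
      x-0≡x : ∀ x → x - 0ℤ ≡ x
      x-0≡x = solve-∀
      x+1≡suc : ∀ x → x + 1ℤ ≡ 1ℤ + x
      x+1≡suc = solve-∀
      w₁i≡ : w₁ i ≡ ℤ.pred (w i)
      w₁i≡ = trans (cong (w i -_) (lookup-e-self i)) (x-1≡pred (w i))
      w₁≗w : ∀ m → i ≢ m → w₁ m ≡ w m
      w₁≗w m i≢m = trans (cong (w m -_) (lookup-e-other i m i≢m)) (x-0≡x (w m))
      w'j≡ : w' j ≡ ℤ.suc (w₁ j)
      w'j≡ = trans (w'≗ j) (trans (cong (λ z → w₁ j + z) (lookup-e-self j)) (x+1≡suc (w₁ j)))
      w'≗w₁ : ∀ m → j ≢ m → w' m ≡ w₁ m
      w'≗w₁ m j≢m = trans (w'≗ m) (trans (cong (λ z → w₁ m + z) (lookup-e-other j m j≢m)) (+-identityʳ (w₁ m)))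

  move-admissible : ∀ ℓ → (∀ u u' i j → i ≢ j → proj₁ u' ≡ shift (proj₁ u) i j → ℓ u' ≡ move i j (ℓ u)) →
    Admissible C ℓ
  move-admissible ℓ ℓ-moves u u' i j i≢j u'≡ = φᴸ i (ℓ u) , proj₂ (line-exists i (ℓ u)) ,
    subst (λ p → Coloured j p (φᴸ i (ℓ u))) (sym (ℓ-moves u u' i j i≢j u'≡)) (proj₂ (point-exists j _))

  admissible-moves : ∀ ℓ → Admissible C ℓ →
    ∀ u u' i j → i ≢ j → proj₁ u' ≡ shift (proj₁ u) i j → ℓ u' ≡ move i j (ℓ u)
  admissible-moves ℓ admissible u u' i j i≢j u'≡ with admissible u u' i j i≢j u'≡
  ... | l , ℓu—l , l—ℓu' = trans (sym (φᴾ-unique l—ℓu')) (cong (φᴾ j) (sym (φᴸ-unique ℓu—l)))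

  module Canonical (v₀ : A k) (p₀ : Point) where

    offset : A k → Colour → ℤ
    offset u m = Vec.lookup (proj₁ u) m - Vec.lookup (proj₁ v₀) m

    canonical : A k → Point
    canonical u = act (λ m → m) (offset u) p₀

    canonical-v₀ : canonical v₀ ≡ p₀
    canonical-v₀ = act-zero (λ m → m) (offset v₀) (λ m → +-inverseʳ (Vec.lookup (proj₁ v₀) m)) p₀

    canonical-admissible : Admissible C canonical
    canonical-admissible = move-admissible canonical λ u u' i j _ u'≡ →
      act-shift (offset u) (offset u') i j (offset-shift u u' i j u'≡) p₀
      where
        offset-shift : ∀ u u' i j → proj₁ u' ≡ shift (proj₁ u) i j →
          ∀ m → offset u' m ≡ offset u m - Vec.lookup (e i) m + Vec.lookup (e j) m
        offset-shift u u' i j u'≡ m = begin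
          Vec.lookup (proj₁ u') m - Vec.lookup (proj₁ v₀) m
            ≡⟨ cong (λ w → Vec.lookup w m - Vec.lookup (proj₁ v₀) m) u'≡ ⟩
          Vec.lookup (shift (proj₁ u) i j) m - Vec.lookup (proj₁ v₀) m
            ≡⟨ cong (_- Vec.lookup (proj₁ v₀) m) (lookup-shift (proj₁ u) i j m) ⟩
          Vec.lookup (proj₁ u) m - Vec.lookup (e i) m + Vec.lookup (e j) m - Vec.lookup (proj₁ v₀) m
            ≡⟨ regroup (Vec.lookup (proj₁ u) m) (Vec.lookup (e i) m) (Vec.lookup (e j) m) _ ⟩
          offset u m - Vec.lookup (e i) m + Vec.lookup (e j) m ∎
          where
            open ≡-Reasoning
            regroup : ∀ x a b y → x - a + b - y ≡ x - y - a + b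
            regroup = solve-∀

  MoveEquivariant : (Point → Point) → Set
  MoveEquivariant σ = ∀ i j q → σ (move i j q) ≡ move i j (σ q)

  admissible-equivariant : ∀ ℓ ℓ' σ → MoveEquivariant σ → Admissible C ℓ → Admissible C ℓ' →
    ∀ v₀ → ℓ' v₀ ≡ σ (ℓ v₀) → ∀ u → ℓ' u ≡ σ (ℓ u)
  admissible-equivariant ℓ ℓ' σ σ-equivariant admissible admissible' v₀ agree u =
    A-connected (λ u → ℓ' u ≡ σ (ℓ u)) step v₀ u agree
    where
      step : ∀ u u' i j → i ≢ j → proj₁ u' ≡ shift (proj₁ u) i j → ℓ' u ≡ σ (ℓ u) → ℓ' u' ≡ σ (ℓ u')
      step u u' i j i≢j u'≡ ℓ'u≡ = begin
        ℓ' u'                ≡⟨ admissible-moves ℓ' admissible' u u' i j i≢j u'≡ ⟩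
        move i j (ℓ' u)      ≡⟨ cong (move i j) ℓ'u≡ ⟩
        move i j (σ (ℓ u))   ≡⟨ sym (σ-equivariant i j (ℓ u)) ⟩
        σ (move i j (ℓ u))   ≡⟨ cong σ (sym (admissible-moves ℓ admissible u u' i j i≢j u'≡)) ⟩
        σ (ℓ u')             ∎
        where open ≡-Reasoning

  move↔ : Colour → Colour → Point ↔ Point
  move↔ i j = mk↔ₛ′ (move i j) (move j i) (move-inverse i j) (move-inverse j i)

  equivariant-permutation : ∀ {p p'} → Star (Adj (R conf)) (inj₁ p) (inj₁ p') →
    Σ (Point ↔ Point) (λ σ → Inverse.to σ p ≡ p' × MoveEquivariant (Inverse.to σ))
  equivariant-permutation ε = ↔-id Point , refl , λ _ _ _ → refl
  equivariant-permutation (_◅_ {j = inj₁ _} () _)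
  equivariant-permutation (_◅_ {j = inj₂ _} _ (_◅_ {j = inj₂ _} () _))
  equivariant-permutation {p} (_◅_ {j = inj₂ l} p—l (_◅_ {j = inj₁ p₁} p₁—l path))
    with equivariant-permutation path
  ... | σ , σp₁≡p' , σ-equivariant =
    σ ↔-∘ move↔ a b , trans (cong (Inverse.to σ) p→p₁) σp₁≡p' ,
    λ i j q → trans (cong (Inverse.to σ) (move-comm a b i j q)) (σ-equivariant i j (move a b q))
    where
      a b : Colour
      a = χ p l p—l
      b = χ p₁ l p₁—l
      p→p₁ : move a b p ≡ p₁
      p→p₁ = trans (cong (φᴾ b) (φᴸ-unique (p—l , refl))) (φᴾ-unique (p₁—l , refl))

lemma5p2 : ∀ {k} (C : ColoredConfiguration (suc k)) →
    ((v₀ : A k) (p₀ : Fin (np (ColoredConfiguration.conf C))) →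
      Σ (A k → Fin (np (ColoredConfiguration.conf C))) (λ ℓ → Admissible C ℓ × ℓ v₀ ≡ p₀)
      × (∀ ℓ₁ ℓ₂ → Admissible C ℓ₁ → Admissible C ℓ₂ → ℓ₁ v₀ ≡ p₀ → ℓ₂ v₀ ≡ p₀ →
          ∀ u → ℓ₁ u ≡ ℓ₂ u))
    × (∀ (v₀ v₀' : A k) (p₀ p₀' : Fin (np (ColoredConfiguration.conf C))) ℓ ℓ' →
        Admissible C ℓ → ℓ v₀ ≡ p₀ → Admissible C ℓ' → ℓ' v₀' ≡ p₀' →
        Σ (Fin (np (ColoredConfiguration.conf C)) ↔ Fin (np (ColoredConfiguration.conf C)))
          (λ σ → ∀ u → ℓ' u ≡ Inverse.to σ (ℓ u)))
lemma5p2 C =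
  (λ v₀ p₀ →
      (canonical v₀ p₀ , canonical-admissible v₀ p₀ , canonical-v₀ v₀ p₀)
    , λ ℓ₁ ℓ₂ admissible₁ admissible₂ ℓ₁v₀≡p₀ ℓ₂v₀≡p₀ →
        admissible-equivariant ℓ₂ ℓ₁ (λ q → q) (λ _ _ _ → refl) admissible₂ admissible₁ v₀
          (trans ℓ₁v₀≡p₀ (sym ℓ₂v₀≡p₀)))
  , λ v₀ _ _ _ ℓ ℓ' admissible _ admissible' _ →
      let σ , σℓv₀≡ℓ'v₀ , σ-equivariant = equivariant-permutation (connected (inj₁ (ℓ v₀)) (inj₁ (ℓ' v₀)))
      in σ , admissible-equivariant ℓ ℓ' (Inverse.to σ) σ-equivariant admissible admissible' v₀ (sym σℓv₀≡ℓ'v₀)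
  where
    open ColoredConfiguration C using (connected)
    open ColourMaps C
    open Canonical
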